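{- There is no derivation of the sequent $\cdot;\cdot\Rightarrow\bot$ in $NL^{\Rightarrow}$.
   Context: Syntax. Types $\tau ::= \delta \mid \nu \mid \langle\nu\rangle\tau$ ($\delta$ data types, $\nu$ name types). Disjoint countably infinite sets of variables and name-symbols $\mathsf a,\mathsf b,\dots$. Signature with constants, function and relation symbols always including swapping $(a\ b)\cdot t$, abstraction $\langle a\rangle t$, equality $t\approx u$, freshness $a\mathrel{\#}t$. Formulas: $\top,\bot$, atoms, $\wedge,\vee,\supset,\forall,\exists$, and the fresh-name quantifier $\mathsf N\mathsf a{:}\nu.\phi$. Contexts $\Sigma ::= \cdot \mid \Sigma,x{:}\tau \mid \Sigma\#\mathsf a{:}\nu$ ($\mathsf a$ fresh for all of $\Sigma$); $|\cdot|=\emptyset$, $|\Sigma,x{:}\tau|=|\Sigma|$, $|\Sigma\#\mathsf a{:}\nu|=|\Sigma|\cup\{\mathsf a\mathrel{\#}t\mid t\text{ well-typed in }\Sigma\}$. Rules of $NL^{\Rightarrow}$: hyp ($\Sigma;\Gamma,P\Rightarrow P,\Delta$, $P$ atomic), $\top R$, $\bot L$, classical G3c rules for $\wedge,\vee,\supset,\forall,\exists$; $\mathsf N R$: from $\Sigma\#\mathsf a{:}\nu;\Gamma\Rightarrow\phi,\Delta$ ($\mathsf a\notin\Sigma$) infer $\Sigma;\Gamma\Rightarrow\mathsf N\mathsf a{:}\nu.\phi,\Delta$; $\mathsf N L$: from $\Sigma\#\mathsf a{:}\nu;\Gamma,\phi\Rightarrow\Delta$ infer $\Sigma;\Gamma,\mathsf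 N\mathsf a{:}\nu.\phi\Rightarrow\Delta$; nonlogical rules $\approx R$ (from $\Gamma,t\approx t\Rightarrow\Delta$ infer $\Gamma\Rightarrow\Delta$), $\approx S$ (from $\Gamma,t\approx u,P(t),P(u)\Rightarrow\Delta$ infer $\Gamma,t\approx u,P(t)\Rightarrow\Delta$), Ax (for each instance $\bigwedge\vec P\supset Q_1\vee\dots\vee Q_m$ of (S1) $(a\ a)\cdot x\approx x$, (S2) $(a\ b)\cdot(a\ b)\cdot x\approx x$, (S3) $(a\ b)\cdot a\approx b$, (E1) $(a\ b)\cdot c\approx c$, (E2) $(a\ b)\cdot f(\vec t)\approx f((a\ b)\cdot\vec t)$, (E3) $p(\vec t)\supset p((a\ b)\cdot\vec t)$, (F1) $a\mathrel{\#}x\wedge b\mathrel{\#}x\supset(a\ b)\cdot x\approx x$, (F2) $a\mathrel{\#}b$ for distinct name types, (F3) $a\mathrel{\#}a\supset\bot$, (F4) $a\mathrel{\#}b\vee a\approx b$, (A1) $a\mathrel{\#}y\wedge x\approx(a\ b)\cdot y\supset\langle a\rangle x\approx\langle b\rangle y$: from $\Gamma,\vec P,Q_i\Rightarrow\Delta$ for all $i$ infer $\Gamma,\vec P\Rightarrow\Delta$), $A_2$ (from $\Gamma,\langle a\rangle t\approx\langle b\rangle u,a\approx b,t\approx u\Rightarrow\Delta$ and $\Gamma,\langle a\rangle t\approx\langle b\rangle u,a\mathrel{\#}u,t\approx(a\ b)\cdot u\Rightarrow\Delta$ infer $\Gamma,\langle a\rangle t\approx\langle b\rangle u\Rightarrow\Delta$),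 $A_3$ (from $\Sigma\vdash t:\langle\nu\rangle\sigma$ and $\Sigma,a{:}\nu,x{:}\sigma;\Gamma,t\approx\langle a\rangle x\Rightarrow\Delta$ infer $\Sigma;\Gamma\Rightarrow\Delta$), $F$ (from $\Sigma\#\mathsf a{:}\nu;\Gamma\Rightarrow\Delta$, $\mathsf a\notin\Sigma$, infer $\Sigma;\Gamma\Rightarrow\Delta$), $\Sigma\#$ (from $\Sigma;\Gamma,\mathsf a\mathrel{\#}t\Rightarrow\Delta$, $\mathsf a\mathrel{\#}t\in|\Sigma|$, infer $\Sigma;\Gamma\Rightarrow\Delta$). -}

module Defs where

open import Data.List using (List; []; _∷_; _++_; map)
open import Data.List.Relation.Unary.All using (All)
open import Data.List.Relation.Binary.Permutation.Propositional using (_↭_)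
open import Relation.Binary.PropositionalEquality using (_≢_)

data Ty (D N : Set) : Set where
  dty : D → Ty D N
  nty : N → Ty D N
  aty : N → Ty D N → Ty D N

-- Besides the user symbols below,
-- the term/formula syntax always contains swapping, abstraction,
-- equality and freshness (built into Term / Form).

record Signature : Set₁ where
  field
    DataTy  : Set
    NameTy  : Set
    Const   : Set
    constTy : Const → DataTy
    Fun     : Set
    funArgs : Fun → List (Ty DataTy NameTy)
    funRes  : Fun → DataTy
    Rel     : Set
    relArgs : Rel → List (Ty DataTy NameTy)

module NL (S : Signature) where
  open Signature S

  Type : Set
  Type = Ty DataTy NameTy

  data Entry : Set where
    V : Type → Entry
    N : NameTy → Entry

  -- contexts Σ ::= · | Σ,x:τ | Σ#a:ν   (de Bruijn; freshness of the
  -- new variable / name-symbol is automatic)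
  data Ctx : Set where
    ∙   : Ctx
    _▷_ : Ctx → Entry → Ctx

  infixl 5 _▷_

  data _∋_ : Ctx → Entry → Set where
    here  : ∀ {Σ e} → (Σ ▷ e) ∋ e
    there : ∀ {Σ e e'} → Σ ∋ e → (Σ ▷ e') ∋ e

  mutual
    data Term (Σ : Ctx) : Type → Set where
      var  : ∀ {τ} → Σ ∋ V τ → Term Σ τ
      nm   : ∀ {ν} → Σ ∋ N ν → Term Σ (nty ν)
      con  : (c : Const) → Term Σ (dty (constTy c))
      app  : (f : Fun) → Terms Σ (funArgs f) → Term Σ (dty (funRes f))
      swap : ∀ {ν τ} → Term Σ (nty ν) → Term Σ (nty ν) → Term Σ τ → Term Σ τ
      abs  : ∀ {ν τ} → Term Σ (nty ν) → Term Σ τ → Term Σ (aty ν τ)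

    data Terms (Σ : Ctx) : List Type → Set where
      []  : Terms Σ []
      _∷_ : ∀ {τ τs} → Term Σ τ → Terms Σ τs → Terms Σ (τ ∷ τs)

  data Form (Σ : Ctx) : Set where
    ⊤ᶠ ⊥ᶠ : Form Σ
    rel  : (p : Rel) → Terms Σ (relArgs p) → Form Σ
    _≈_  : ∀ {τ} → Term Σ τ → Term Σ τ → Form Σ
    _#_  : ∀ {ν τ} → Term Σ (nty ν) → Term Σ τ → Form Σ
    _∧_ _∨_ _⊃_ : Form Σ → Form Σ → Form Σ
    all ex : (τ : Type) → Form (Σ ▷ V τ) → Form Σ
    new  : (ν : NameTy) → Form (Σ ▷ N ν) → Form Σ

  infix 6 _≈_ _#_

  data Atomic {Σ : Ctx} : Form Σ → Set where
    rel : ∀ p ts → Atomic (rel p ts)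
    eq  : ∀ {τ} (t u : Term Σ τ) → Atomic (t ≈ u)
    fr  : ∀ {ν τ} (a : Term Σ (nty ν)) (t : Term Σ τ) → Atomic (a # t)

  swapTs : ∀ {Σ ν τs} → Term Σ (nty ν) → Term Σ (nty ν) → Terms Σ τs → Terms Σ τs
  swapTs a b []       = []
  swapTs a b (t ∷ ts) = swap a b t ∷ swapTs a b ts

  Ren : Ctx → Ctx → Set
  Ren Σ Σ' = ∀ {e} → Σ ∋ e → Σ' ∋ e

  liftR : ∀ {Σ Σ' e} → Ren Σ Σ' → Ren (Σ ▷ e) (Σ' ▷ e)
  liftR ρ here      = here
  liftR ρ (there x) = there (ρ x)

  mutual
    renT : ∀ {Σ Σ' τ} → Ren Σ Σ' → Term Σ τ → Term Σ' τ
    renT ρ (var x)      = var (ρ x)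
    renT ρ (nm a)       = nm (ρ a)
    renT ρ (con c)      = con c
    renT ρ (app f ts)   = app f (renTs ρ ts)
    renT ρ (swap a b t) = swap (renT ρ a) (renT ρ b) (renT ρ t)
    renT ρ (abs a t)    = abs (renT ρ a) (renT ρ t)

    renTs : ∀ {Σ Σ' τs} → Ren Σ Σ' → Terms Σ τs → Terms Σ' τs
    renTs ρ []       = []
    renTs ρ (t ∷ ts) = renT ρ t ∷ renTs ρ ts

  renF : ∀ {Σ Σ'} → Ren Σ Σ' → Form Σ → Form Σ'
  renF ρ ⊤ᶠ        = ⊤ᶠ
  renF ρ ⊥ᶠ        = ⊥ᶠ
  renF ρ (rel p ts) = rel p (renTs ρ ts)
  renF ρ (t ≈ u)   = renT ρ t ≈ renT ρ u
  renF ρ (a # t)   = renT ρ a # renT ρ t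
  renF ρ (φ ∧ ψ)   = renF ρ φ ∧ renF ρ ψ
  renF ρ (φ ∨ ψ)   = renF ρ φ ∨ renF ρ ψ
  renF ρ (φ ⊃ ψ)   = renF ρ φ ⊃ renF ρ ψ
  renF ρ (all τ φ) = all τ (renF (liftR ρ) φ)
  renF ρ (ex τ φ)  = ex τ (renF (liftR ρ) φ)
  renF ρ (new ν φ) = new ν (renF (liftR ρ) φ)

  wkT : ∀ {Σ e τ} → Term Σ τ → Term (Σ ▷ e) τ
  wkT = renT there

  wkF : ∀ {Σ e} → Form Σ → Form (Σ ▷ e)
  wkF = renF there

  wkL : ∀ {Σ e} → List (Form Σ) → List (Form (Σ ▷ e))
  wkL = map wkF

  Val : Ctx → Entry → Set
  Val Σ (V τ) = Term Σ τ
  Val Σ (N ν) = Σ ∋ N ν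

  Sub : Ctx → Ctx → Set
  Sub Σ Σ' = ∀ {e} → Σ ∋ e → Val Σ' e

  renV : ∀ {Σ Σ'} e → Ren Σ Σ' → Val Σ e → Val Σ' e
  renV (V τ) ρ t = renT ρ t
  renV (N ν) ρ a = ρ a

  topV : ∀ {Σ} e → Val (Σ ▷ e) e
  topV (V τ) = var here
  topV (N ν) = here

  idV : ∀ {Σ} e → Σ ∋ e → Val Σ e
  idV (V τ) x = var x
  idV (N ν) a = a

  liftS : ∀ {Σ Σ' e} → Sub Σ Σ' → Sub (Σ ▷ e) (Σ' ▷ e)
  liftS {e = e} σ here           = topV e
  liftS         σ (there {e = e'} x) = renV e' there (σ x)

  mutual
    subT : ∀ {Σ Σ' τ} → Sub Σ Σ' → Term Σ τ → Term Σ' τ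
    subT σ (var x)      = σ x
    subT σ (nm a)       = nm (σ a)
    subT σ (con c)      = con c
    subT σ (app f ts)   = app f (subTs σ ts)
    subT σ (swap a b t) = swap (subT σ a) (subT σ b) (subT σ t)
    subT σ (abs a t)    = abs (subT σ a) (subT σ t)

    subTs : ∀ {Σ Σ' τs} → Sub Σ Σ' → Terms Σ τs → Terms Σ' τs
    subTs σ []       = []
    subTs σ (t ∷ ts) = subT σ t ∷ subTs σ ts

  subF : ∀ {Σ Σ'} → Sub Σ Σ' → Form Σ → Form Σ'
  subF σ ⊤ᶠ        = ⊤ᶠ
  subF σ ⊥ᶠ        = ⊥ᶠ
  subF σ (rel p ts) = rel p (subTs σ ts)
  subF σ (t ≈ u)   = subT σ t ≈ subT σ u
  subF σ (a # t)   = subT σ a # subT σ t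
  subF σ (φ ∧ ψ)   = subF σ φ ∧ subF σ ψ
  subF σ (φ ∨ ψ)   = subF σ φ ∨ subF σ ψ
  subF σ (φ ⊃ ψ)   = subF σ φ ⊃ subF σ ψ
  subF σ (all τ φ) = all τ (subF (liftS σ) φ)
  subF σ (ex τ φ)  = ex τ (subF (liftS σ) φ)
  subF σ (new ν φ) = new ν (subF (liftS σ) φ)

  single : ∀ {Σ τ} → Term Σ τ → Sub (Σ ▷ V τ) Σ
  single t here               = t
  single t (there {e = e} x)  = idV e x

  _[_] : ∀ {Σ τ} → Form (Σ ▷ V τ) → Term Σ τ → Form Σ
  φ [ t ] = subF (single t) φ

  data FreshFact : (Σ : Ctx) → Form Σ → Set where
    newName : ∀ {Σ ν τ} (t : Term Σ τ) →
              FreshFact (Σ ▷ N ν) (nm here # wkT t)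
    older   : ∀ {Σ e φ} → FreshFact Σ φ → FreshFact (Σ ▷ e) (wkF φ)

  -- Instances  ⋀P⃗ ⊃ Q₁ ∨ … ∨ Qₘ  of the axiom schemes; indexed by P⃗ and Q⃗.

  data Axiom (Σ : Ctx) : List (Form Σ) → List (Form Σ) → Set where
    S1 : ∀ {ν τ} (a : Term Σ (nty ν)) (x : Term Σ τ) →
         Axiom Σ [] (swap a a x ≈ x ∷ [])
    S2 : ∀ {ν τ} (a b : Term Σ (nty ν)) (x : Term Σ τ) →
         Axiom Σ [] (swap a b (swap a b x) ≈ x ∷ [])
    S3 : ∀ {ν} (a b : Term Σ (nty ν)) →
         Axiom Σ [] (swap a b a ≈ b ∷ [])
    E1 : ∀ {ν} (a b : Term Σ (nty ν)) (c : Const) →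
         Axiom Σ [] (swap a b (con c) ≈ con c ∷ [])
    -- E2 for every function symbol: user symbols, swapping, abstraction
    E2 : ∀ {ν} (a b : Term Σ (nty ν)) (f : Fun) (ts : Terms Σ (funArgs f)) →
         Axiom Σ [] (swap a b (app f ts) ≈ app f (swapTs a b ts) ∷ [])
    E2swap : ∀ {ν ν' τ} (a b : Term Σ (nty ν)) (c d : Term Σ (nty ν')) (t : Term Σ τ) →
         Axiom Σ [] (swap a b (swap c d t) ≈ swap (swap a b c) (swap a b d) (swap a b t) ∷ [])
    E2abs : ∀ {ν ν' τ} (a b : Term Σ (nty ν)) (c : Term Σ (nty ν')) (t : Term Σ τ) →
         Axiom Σ [] (swap a b (abs c t) ≈ abs (swap a b c) (swap a b t) ∷ [])
    -- E3 for every relation symbol: user symbols, equality, freshness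
    E3 : ∀ {ν} (a b : Term Σ (nty ν)) (p : Rel) (ts : Terms Σ (relArgs p)) →
         Axiom Σ (rel p ts ∷ []) (rel p (swapTs a b ts) ∷ [])
    E3eq : ∀ {ν τ} (a b : Term Σ (nty ν)) (t u : Term Σ τ) →
         Axiom Σ (t ≈ u ∷ []) (swap a b t ≈ swap a b u ∷ [])
    E3fr : ∀ {ν ν' τ} (a b : Term Σ (nty ν)) (c : Term Σ (nty ν')) (t : Term Σ τ) →
         Axiom Σ (c # t ∷ []) (swap a b c # swap a b t ∷ [])
    F1 : ∀ {ν τ} (a b : Term Σ (nty ν)) (x : Term Σ τ) →
         Axiom Σ (a # x ∷ b # x ∷ []) (swap a b x ≈ x ∷ [])
    F2 : ∀ {ν ν'} → ν ≢ ν' → (a : Term Σ (nty ν)) (b : Term Σ (nty ν')) →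
         Axiom Σ [] (a # b ∷ [])
    F3 : ∀ {ν} (a : Term Σ (nty ν)) →
         Axiom Σ (a # a ∷ []) []
    F4 : ∀ {ν} (a b : Term Σ (nty ν)) →
         Axiom Σ [] (a # b ∷ a ≈ b ∷ [])
    A1 : ∀ {ν τ} (a b : Term Σ (nty ν)) (x y : Term Σ τ) →
         Axiom Σ (a # y ∷ x ≈ swap a b y ∷ []) (abs a x ≈ abs b y ∷ [])

  -- Derivations of  Σ ; Γ ⇒ Δ.  Γ, Δ are multisets, represented as lists
  -- taken up to permutation (rule `perm`); "Γ, φ" is written φ ∷ Γ.

  data _⨾_⇒_ : (Σ : Ctx) → List (Form Σ) → List (Form Σ) → Set where
    perm : ∀ {Σ Γ Γ' Δ Δ'} → Γ ↭ Γ' → Δ ↭ Δ' → Σ ⨾ Γ ⇒ Δ → Σ ⨾ Γ' ⇒ Δ'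
    hyp  : ∀ {Σ Γ Δ} {P : Form Σ} → Atomic P → Σ ⨾ P ∷ Γ ⇒ P ∷ Δ
    ⊤R   : ∀ {Σ Γ Δ} → Σ ⨾ Γ ⇒ ⊤ᶠ ∷ Δ
    ⊥L   : ∀ {Σ Γ Δ} → Σ ⨾ ⊥ᶠ ∷ Γ ⇒ Δ
    ∧L   : ∀ {Σ Γ Δ φ ψ} → Σ ⨾ φ ∷ ψ ∷ Γ ⇒ Δ → Σ ⨾ (φ ∧ ψ) ∷ Γ ⇒ Δ
    ∧R   : ∀ {Σ Γ Δ φ ψ} → Σ ⨾ Γ ⇒ φ ∷ Δ → Σ ⨾ Γ ⇒ ψ ∷ Δ → Σ ⨾ Γ ⇒ (φ ∧ ψ) ∷ Δ
    ∨L   : ∀ {Σ Γ Δ φ ψ} → Σ ⨾ φ ∷ Γ ⇒ Δ → Σ ⨾ ψ ∷ Γ ⇒ Δ → Σ ⨾ (φ ∨ ψ) ∷ Γ ⇒ Δ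
    ∨R   : ∀ {Σ Γ Δ φ ψ} → Σ ⨾ Γ ⇒ φ ∷ ψ ∷ Δ → Σ ⨾ Γ ⇒ (φ ∨ ψ) ∷ Δ
    ⊃L   : ∀ {Σ Γ Δ φ ψ} → Σ ⨾ Γ ⇒ φ ∷ Δ → Σ ⨾ ψ ∷ Γ ⇒ Δ → Σ ⨾ (φ ⊃ ψ) ∷ Γ ⇒ Δ
    ⊃R   : ∀ {Σ Γ Δ φ ψ} → Σ ⨾ φ ∷ Γ ⇒ ψ ∷ Δ → Σ ⨾ Γ ⇒ (φ ⊃ ψ) ∷ Δ
    ∀L   : ∀ {Σ Γ Δ τ φ} (t : Term Σ τ) →
           Σ ⨾ (φ [ t ]) ∷ all τ φ ∷ Γ ⇒ Δ → Σ ⨾ all τ φ ∷ Γ ⇒ Δ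
    ∀R   : ∀ {Σ Γ Δ τ φ} →
           (Σ ▷ V τ) ⨾ wkL Γ ⇒ φ ∷ wkL Δ → Σ ⨾ Γ ⇒ all τ φ ∷ Δ
    ∃L   : ∀ {Σ Γ Δ τ φ} →
           (Σ ▷ V τ) ⨾ φ ∷ wkL Γ ⇒ wkL Δ → Σ ⨾ ex τ φ ∷ Γ ⇒ Δ
    ∃R   : ∀ {Σ Γ Δ τ φ} (t : Term Σ τ) →
           Σ ⨾ Γ ⇒ ex τ φ ∷ (φ [ t ]) ∷ Δ → Σ ⨾ Γ ⇒ ex τ φ ∷ Δ
    ИR   : ∀ {Σ Γ Δ ν φ} →
           (Σ ▷ N ν) ⨾ wkL Γ ⇒ φ ∷ wkL Δ → Σ ⨾ Γ ⇒ new ν φ ∷ Δ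
    ИL   : ∀ {Σ Γ Δ ν φ} →
           (Σ ▷ N ν) ⨾ φ ∷ wkL Γ ⇒ wkL Δ → Σ ⨾ new ν φ ∷ Γ ⇒ Δ
    ≈R   : ∀ {Σ Γ Δ τ} (t : Term Σ τ) →
           Σ ⨾ (t ≈ t) ∷ Γ ⇒ Δ → Σ ⨾ Γ ⇒ Δ
    ≈S   : ∀ {Σ Γ Δ τ} (t u : Term Σ τ) (P : Form (Σ ▷ V τ)) → Atomic P →
           Σ ⨾ (t ≈ u) ∷ (P [ t ]) ∷ (P [ u ]) ∷ Γ ⇒ Δ →
           Σ ⨾ (t ≈ u) ∷ (P [ t ]) ∷ Γ ⇒ Δ
    Ax   : ∀ {Σ Γ Δ Ps Qs} → Axiom Σ Ps Qs →
           All (λ Q → Σ ⨾ Q ∷ (Ps ++ Γ) ⇒ Δ) Qs →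
           Σ ⨾ Ps ++ Γ ⇒ Δ
    A2   : ∀ {Σ Γ Δ ν τ} (a b : Term Σ (nty ν)) (t u : Term Σ τ) →
           Σ ⨾ (abs a t ≈ abs b u) ∷ (a ≈ b) ∷ (t ≈ u) ∷ Γ ⇒ Δ →
           Σ ⨾ (abs a t ≈ abs b u) ∷ (a # u) ∷ (t ≈ swap a b u) ∷ Γ ⇒ Δ →
           Σ ⨾ (abs a t ≈ abs b u) ∷ Γ ⇒ Δ
    A3   : ∀ {Σ Γ Δ ν σ} (t : Term Σ (aty ν σ)) →
           (Σ ▷ V (nty ν) ▷ V σ) ⨾
             (wkT (wkT t) ≈ abs (var (there here)) (var here)) ∷ wkL (wkL Γ)
             ⇒ wkL (wkL Δ) →
           Σ ⨾ Γ ⇒ Δ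
    F    : ∀ {Σ Γ Δ ν} → (Σ ▷ N ν) ⨾ wkL Γ ⇒ wkL Δ → Σ ⨾ Γ ⇒ Δ
    Σ#   : ∀ {Σ Γ Δ φ} → FreshFact Σ φ → Σ ⨾ φ ∷ Γ ⇒ Δ → Σ ⨾ Γ ⇒ Δ

  infix 3 _⨾_⇒_

-- Interpret NL⇒ in the model of α-terms in locally nameless form: name-symbols denote
-- atoms (natural numbers, each assigned a name type), ⟨a⟩t denotes the body t with a
-- closed over, every data term denotes one unit value and every relation holds. A
-- derivation of Σ ; Γ ⇒ Δ in which Γ consists of atoms true in the model and Δ only of ⊥
-- is impossible: no logical rule applies to such a sequent, and each nonlogical rule
-- preserves this shape. Rule A2 holds because two equal abstractions of locally closed
-- bodies either share name and body or have bodies related by a transposition of a fresh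
-- name, A3 because every value of abstraction type is an abstraction, and F because an
-- atom beyond every atom in use is fresh for all values.

module Submission where

open import Data.Nat using (ℕ; suc; _<_; _≟_)
open import Data.Nat.Properties using (<-irrefl; m≤n⇒m≤1+n; n<1+n)
open import Data.Empty using (⊥; ⊥-elim)
open import Data.Unit using (⊤; tt)
open import Data.Maybe using (Maybe; just; nothing)
open import Data.Maybe.Properties using (just-injective)
open import Data.Product using (∃; _×_; _,_; proj₁)
open import Data.Sum using (_⊎_; inj₁; inj₂)
open import Data.List using (List; []; _∷_)
open import Data.List.Relation.Unary.All using (All; []; _∷_) renaming (map to All-map)
open import Data.List.Relation.Unary.Any using (Any; here; there)
open import Data.List.Relation.Unary.All.Properties using (++⁻ˡ; map⁺)
open import Data.List.Relation.Binary.Permutation.Propositional using (↭-sym)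
open import Data.List.Relation.Binary.Permutation.Propositional.Properties using (All-resp-↭)
open import Function using (id; _∘_)
open import Function.Definitions using (Injective)
open import Relation.Nullary using (yes; no; ¬_)
open import Relation.Binary.PropositionalEquality hiding ([_])
open import Defs

transpose : ℕ → ℕ → ℕ → ℕ
transpose n m k with k ≟ n
... | yes _ = m
... | no _ with k ≟ m
...   | yes _ = n
...   | no _ = k

data TransposeView (n m k : ℕ) : ℕ → Set where
  left  : k ≡ n → TransposeView n m k m
  right : k ≡ m → TransposeView n m k n
  other : k ≢ n → k ≢ m → TransposeView n m k k

transposeView : ∀ n m k → TransposeView n m k (transpose n m k)
transposeView n m k with k ≟ n
... | yes p = left p
... | no p with k ≟ m
...   | yes q = right q
...   | no q = other p q

transpose-left : ∀ n m → transpose n m n ≡ m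
transpose-left n m with transpose n m n | transposeView n m n
... | _ | left _    = refl
... | _ | right n≡m = n≡m
... | _ | other n≢n _ = ⊥-elim (n≢n refl)

transpose-right : ∀ n m → transpose n m m ≡ n
transpose-right n m with transpose n m m | transposeView n m m
... | _ | left m≡n  = m≡n
... | _ | right _   = refl
... | _ | other _ m≢m = ⊥-elim (m≢m refl)

transpose-other : ∀ {n m k} → k ≢ n → k ≢ m → transpose n m k ≡ k
transpose-other {n} {m} {k} k≢n k≢m with transpose n m k | transposeView n m k
... | _ | left k≡n  = ⊥-elim (k≢n k≡n)
... | _ | right k≡m = ⊥-elim (k≢m k≡m)
... | _ | other _ _ = refl

transpose-self : ∀ n k → transpose n n k ≡ k
transpose-self n k with transpose n n k | transposeView n n k
... | _ | left k≡n  = sym k≡n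
... | _ | right k≡n = sym k≡n
... | _ | other _ _ = refl

transpose-involutive : ∀ n m k → transpose n m (transpose n m k) ≡ k
transpose-involutive n m k with transpose n m k | transposeView n m k
... | _ | left k≡n      = trans (transpose-right n m) (sym k≡n)
... | _ | right k≡m     = trans (transpose-left n m) (sym k≡m)
... | _ | other k≢n k≢m = transpose-other k≢n k≢m

transpose-injective : ∀ n m → Injective _≡_ _≡_ (transpose n m)
transpose-injective n m {x} {y} eq = begin
  x                                   ≡⟨ sym (transpose-involutive n m x) ⟩
  transpose n m (transpose n m x)     ≡⟨ cong (transpose n m) eq ⟩
  transpose n m (transpose n m y)     ≡⟨ transpose-involutive n m y ⟩
  y                                   ∎
  where open ≡-Reasoning

transpose-conjugate : ∀ π → Injective _≡_ _≡_ π → ∀ k l x →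
                      π (transpose k l x) ≡ transpose (π k) (π l) (π x)
transpose-conjugate π π-inj k l x with transpose k l x | transposeView k l x
... | _ | left refl  = sym (transpose-left (π k) (π l))
... | _ | right refl = sym (transpose-right (π k) (π l))
... | _ | other x≢k x≢l = sym (transpose-other (x≢k ∘ π-inj) (x≢l ∘ π-inj))

transpose-closed : ∀ (P : ℕ → Set) {n m k} → P n → P m → P k → P (transpose n m k)
transpose-closed P {n} {m} {k} pn pm pk with transpose n m k | transposeView n m k
... | _ | left _    = pm
... | _ | right _   = pn
... | _ | other _ _ = pk

transpose-respects : ∀ {A : Set} (f : ℕ → A) {n m} k → f n ≡ f m →
                     f (transpose n m k) ≡ f k
transpose-respects f {n} {m} k fn≡fm with transpose n m k | transposeView n m k
... | _ | left refl  = sym fn≡fm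
... | _ | right refl = fn≡fm
... | _ | other _ _  = refl

data LN : Set where
  unit   : LN
  fv bv  : ℕ → LN
  lam    : LN → LN

lam-injective : ∀ {M M′} → lam M ≡ lam M′ → M ≡ M′
lam-injective refl = refl

rename : (ℕ → ℕ) → LN → LN
rename f unit    = unit
rename f (fv n)  = fv (f n)
rename f (bv i)  = bv i
rename f (lam M) = lam (rename f M)

close : ℕ → ℕ → LN → LN
close k a unit = unit
close k a (fv n) with n ≟ a
... | yes _ = bv k
... | no _  = fv n
close k a (bv i)  = bv i
close k a (lam M) = lam (close (suc k) a M)

open′ : ℕ → ℕ → LN → LN
open′ k a unit   = unit
open′ k a (fv n) = fv n
open′ k a (bv i) with i ≟ k
... | yes _ = fv a
... | no _  = bv i
open′ k a (lam M) = lam (open′ (suc k) a M)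

Fresh : ℕ → LN → Set
Fresh a unit    = ⊤
Fresh a (fv n)  = a ≢ n
Fresh a (bv i)  = ⊤
Fresh a (lam M) = Fresh a M

FvBelow : ℕ → LN → Set
FvBelow B unit    = ⊤
FvBelow B (fv n)  = n < B
FvBelow B (bv i)  = ⊤
FvBelow B (lam M) = FvBelow B M

LocallyClosed : ℕ → LN → Set
LocallyClosed k unit    = ⊤
LocallyClosed k (fv n)  = ⊤
LocallyClosed k (bv i)  = i < k
LocallyClosed k (lam M) = LocallyClosed (suc k) M

close-fv-≡ : ∀ k a → close k a (fv a) ≡ bv k
close-fv-≡ k a with a ≟ a
... | yes _   = refl
... | no a≢a  = ⊥-elim (a≢a refl)

close-fv-≢ : ∀ k {a n} → n ≢ a → close k a (fv n) ≡ fv n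
close-fv-≢ k {a} {n} n≢a with n ≟ a
... | yes n≡a = ⊥-elim (n≢a n≡a)
... | no _    = refl

rename-cong : ∀ {f g} → (∀ x → f x ≡ g x) → ∀ M → rename f M ≡ rename g M
rename-cong f≗g unit    = refl
rename-cong f≗g (fv n)  = cong fv (f≗g n)
rename-cong f≗g (bv i)  = refl
rename-cong f≗g (lam M) = cong lam (rename-cong f≗g M)

rename-id : ∀ M → rename id M ≡ M
rename-id unit    = refl
rename-id (fv n)  = refl
rename-id (bv i)  = refl
rename-id (lam M) = cong lam (rename-id M)

rename-∘ : ∀ f g M → rename f (rename g M) ≡ rename (f ∘ g) M
rename-∘ f g unit    = refl
rename-∘ f g (fv n)  = refl
rename-∘ f g (bv i)  = refl
rename-∘ f g (lam M) = cong lam (rename-∘ f g M)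

rename-close : ∀ f → Injective _≡_ _≡_ f → ∀ k a M →
               rename f (close k a M) ≡ close k (f a) (rename f M)
rename-close f f-inj k a unit = refl
rename-close f f-inj k a (fv n) with n ≟ a
... | yes refl = sym (close-fv-≡ k (f n))
... | no n≢a   = sym (close-fv-≢ k (n≢a ∘ f-inj))
rename-close f f-inj k a (bv i)  = refl
rename-close f f-inj k a (lam M) = cong lam (rename-close f f-inj (suc k) a M)

Fresh-rename : ∀ f → Injective _≡_ _≡_ f → ∀ {a} M → Fresh a M → Fresh (f a) (rename f M)
Fresh-rename f f-inj unit    _   = tt
Fresh-rename f f-inj (fv n)  a≢n = a≢n ∘ f-inj
Fresh-rename f f-inj (bv i)  _   = tt
Fresh-rename f f-inj (lam M) a#M = Fresh-rename f f-inj M a#M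

rename-transpose-fresh : ∀ {n m} M → Fresh n M → Fresh m M → rename (transpose n m) M ≡ M
rename-transpose-fresh unit    _   _   = refl
rename-transpose-fresh (fv k)  n≢k m≢k = cong fv (transpose-other (n≢k ∘ sym) (m≢k ∘ sym))
rename-transpose-fresh (bv i)  _   _   = refl
rename-transpose-fresh (lam M) n#M m#M = cong lam (rename-transpose-fresh M n#M m#M)

close-rename-transpose : ∀ k {a b} M → Fresh a M →
                         close k a (rename (transpose a b) M) ≡ close k b M
close-rename-transpose k {a} {b} unit _ = refl
close-rename-transpose k {a} {b} (fv n) a≢n with n ≟ b
... | yes refl = begin
  close k a (fv (transpose a n n)) ≡⟨ cong (close k a ∘ fv) (transpose-right a n) ⟩
  close k a (fv a)                 ≡⟨ close-fv-≡ k a ⟩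
  bv k                             ∎
  where open ≡-Reasoning
... | no n≢b = begin
  close k a (fv (transpose a b n)) ≡⟨ cong (close k a ∘ fv) (transpose-other (a≢n ∘ sym) n≢b) ⟩
  close k a (fv n)                 ≡⟨ close-fv-≢ k (a≢n ∘ sym) ⟩
  fv n                             ∎
  where open ≡-Reasoning
close-rename-transpose k (bv i)  _   = refl
close-rename-transpose k (lam M) a#M = cong lam (close-rename-transpose (suc k) M a#M)

LocallyClosed-rename : ∀ f k M → LocallyClosed k M → LocallyClosed k (rename f M)
LocallyClosed-rename f k unit    _  = tt
LocallyClosed-rename f k (fv n)  _  = tt
LocallyClosed-rename f k (bv i)  lc = lc
LocallyClosed-rename f k (lam M) lc = LocallyClosed-rename f (suc k) M lc

LocallyClosed-close : ∀ k a M → LocallyClosed k M → LocallyClosed (suc k) (close k a M)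
LocallyClosed-close k a unit _ = tt
LocallyClosed-close k a (fv n) _ with n ≟ a
... | yes _ = n<1+n k
... | no _  = tt
LocallyClosed-close k a (bv i)  lc = m≤n⇒m≤1+n lc
LocallyClosed-close k a (lam M) lc = LocallyClosed-close (suc k) a M lc

open-close : ∀ k a M → LocallyClosed k M → open′ k a (close k a M) ≡ M
open-close k a unit _ = refl
open-close k a (fv n) _ with n ≟ a
... | no _ = refl
... | yes refl with k ≟ k
...   | yes _   = refl
...   | no k≢k  = ⊥-elim (k≢k refl)
open-close k a (bv i) i<k with i ≟ k
... | yes refl = ⊥-elim (<-irrefl refl i<k)
... | no _     = refl
open-close k a (lam M) lc = cong lam (open-close (suc k) a M lc)

close-injective : ∀ k a {M M′} → LocallyClosed k M → LocallyClosed k M′ →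
                  close k a M ≡ close k a M′ → M ≡ M′
close-injective k a {M} {M′} lc lc′ eq = begin
  M                        ≡⟨ sym (open-close k a M lc) ⟩
  open′ k a (close k a M)  ≡⟨ cong (open′ k a) eq ⟩
  open′ k a (close k a M′) ≡⟨ open-close k a M′ lc′ ⟩
  M′                       ∎
  where open ≡-Reasoning

Fresh-close : ∀ k a M → Fresh a (close k a M)
Fresh-close k a unit = tt
Fresh-close k a (fv n) with n ≟ a
... | yes _  = tt
... | no n≢a = n≢a ∘ sym
Fresh-close k a (bv i)  = tt
Fresh-close k a (lam M) = Fresh-close (suc k) a M

Fresh-close⁻ : ∀ k {a n} M → Fresh n (close k a M) → n ≢ a → Fresh n M
Fresh-close⁻ k unit _ _ = tt
Fresh-close⁻ k {a} (fv j) n#M n≢a with j ≟ a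
... | yes refl = n≢a
... | no _     = n#M
Fresh-close⁻ k (bv i)  _   _   = tt
Fresh-close⁻ k (lam M) n#M n≢a = Fresh-close⁻ (suc k) M n#M n≢a

FvBelow-close : ∀ B k a M → FvBelow B M → FvBelow B (close k a M)
FvBelow-close B k a unit _ = tt
FvBelow-close B k a (fv n) n<B with n ≟ a
... | yes _ = tt
... | no _  = n<B
FvBelow-close B k a (bv i)  _  = tt
FvBelow-close B k a (lam M) bM = FvBelow-close B (suc k) a M bM

FvBelow⇒Fresh : ∀ B M → FvBelow B M → Fresh B M
FvBelow⇒Fresh B unit    _   = tt
FvBelow⇒Fresh B (fv n)  n<B = λ B≡n → <-irrefl (sym B≡n) n<B
FvBelow⇒Fresh B (bv i)  _   = tt
FvBelow⇒Fresh B (lam M) bM  = FvBelow⇒Fresh B M bM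

-- The clauses on non-atoms are junk: well-typed evaluation only applies these to atoms.
swapᵛ : LN → LN → LN → LN
swapᵛ (fv n) (fv m) M = rename (transpose n m) M
swapᵛ _      _      M = M

absᵛ : LN → LN → LN
absᵛ (fv n) M = lam (close 0 n M)
absᵛ _      M = unit

freshᵛ : LN → LN → Set
freshᵛ (fv n) M = Fresh n M
freshᵛ _      M = ⊥

IsAtom : LN → Set
IsAtom A = ∃ λ n → A ≡ fv n

swapᵛ-self : ∀ {A} → IsAtom A → ∀ M → swapᵛ A A M ≡ M
swapᵛ-self (n , refl) M = trans (rename-cong (transpose-self n) M) (rename-id M)

swapᵛ-involutive : ∀ {A B} → IsAtom A → IsAtom B → ∀ M → swapᵛ A B (swapᵛ A B M) ≡ M
swapᵛ-involutive (n , refl) (m , refl) M = begin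
  rename (transpose n m) (rename (transpose n m) M) ≡⟨ rename-∘ _ _ M ⟩
  rename (transpose n m ∘ transpose n m) M          ≡⟨ rename-cong (transpose-involutive n m) M ⟩
  rename id M                                       ≡⟨ rename-id M ⟩
  M                                                 ∎
  where open ≡-Reasoning

swapᵛ-left : ∀ {A B} → IsAtom A → IsAtom B → swapᵛ A B A ≡ B
swapᵛ-left (n , refl) (m , refl) = cong fv (transpose-left n m)

swapᵛ-unit : ∀ {A B} → IsAtom A → IsAtom B → swapᵛ A B unit ≡ unit
swapᵛ-unit (n , refl) (m , refl) = refl

swapᵛ-swapᵛ : ∀ {A B C D} → IsAtom A → IsAtom B → IsAtom C → IsAtom D → ∀ M →
              swapᵛ A B (swapᵛ C D M) ≡ swapᵛ (swapᵛ A B C) (swapᵛ A B D) (swapᵛ A B M)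
swapᵛ-swapᵛ (n , refl) (m , refl) (k , refl) (l , refl) M = begin
  rename π (rename (transpose k l) M)     ≡⟨ rename-∘ π _ M ⟩
  rename (π ∘ transpose k l) M            ≡⟨ rename-cong (transpose-conjugate π (transpose-injective n m) k l) M ⟩
  rename (transpose (π k) (π l) ∘ π) M    ≡⟨ sym (rename-∘ _ π M) ⟩
  rename (transpose (π k) (π l)) (rename π M) ∎
  where
  open ≡-Reasoning
  π = transpose n m

swapᵛ-absᵛ : ∀ {A B C} → IsAtom A → IsAtom B → IsAtom C → ∀ M →
             swapᵛ A B (absᵛ C M) ≡ absᵛ (swapᵛ A B C) (swapᵛ A B M)
swapᵛ-absᵛ (n , refl) (m , refl) (k , refl) M =
  cong lam (rename-close (transpose n m) (transpose-injective n m) 0 k M)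

swapᵛ-freshᵛ : ∀ {A B C} → IsAtom A → IsAtom B → IsAtom C → ∀ M →
               freshᵛ C M → freshᵛ (swapᵛ A B C) (swapᵛ A B M)
swapᵛ-freshᵛ (n , refl) (m , refl) (k , refl) M =
  Fresh-rename (transpose n m) (transpose-injective n m) M

swapᵛ-fresh : ∀ {A B} → IsAtom A → IsAtom B → ∀ M →
              freshᵛ A M → freshᵛ B M → swapᵛ A B M ≡ M
swapᵛ-fresh (n , refl) (m , refl) = rename-transpose-fresh

freshᵛ-irrefl : ∀ {A} → IsAtom A → ¬ freshᵛ A A
freshᵛ-irrefl (n , refl) n≢n = n≢n refl

freshᵛ-or-≡ : ∀ {A B} → IsAtom A → IsAtom B → freshᵛ A B ⊎ A ≡ B
freshᵛ-or-≡ (n , refl) (m , refl) with n ≟ m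
... | yes n≡m = inj₂ (cong fv n≡m)
... | no n≢m  = inj₁ n≢m

absᵛ-α : ∀ {A B} → IsAtom A → IsAtom B → ∀ X Y →
         freshᵛ A Y → X ≡ swapᵛ A B Y → absᵛ A X ≡ absᵛ B Y
absᵛ-α (n , refl) (m , refl) X Y n#Y refl = cong lam (close-rename-transpose 0 Y n#Y)

absᵛ-inversion : ∀ {A B} → IsAtom A → IsAtom B → ∀ {T U} →
                 LocallyClosed 0 T → LocallyClosed 0 U → absᵛ A T ≡ absᵛ B U →
                 (A ≡ B × T ≡ U) ⊎ (freshᵛ A U × T ≡ swapᵛ A B U)
absᵛ-inversion (n , refl) (m , refl) {T} {U} lcT lcU eq with n ≟ m
... | yes refl = inj₁ (refl , close-injective 0 n lcT lcU (lam-injective eq))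
... | no n≢m = inj₂ (n#U , close-injective 0 n lcT (LocallyClosed-rename _ 0 U lcU) bodies)
  where
  n#U : Fresh n U
  n#U = Fresh-close⁻ 0 U (subst (Fresh n) (lam-injective eq) (Fresh-close 0 n T)) n≢m
  bodies : close 0 n T ≡ close 0 n (rename (transpose n m) U)
  bodies = trans (lam-injective eq) (sym (close-rename-transpose 0 U n#U))

cong₃ : ∀ {A B C D : Set} (f : A → B → C → D) {x x′ y y′ z z′} →
        x ≡ x′ → y ≡ y′ → z ≡ z′ → f x y z ≡ f x′ y′ z′
cong₃ f refl refl refl = refl

module Model (S : Signature) where
  open Signature S
  open NL S

  -- Atoms below the bound B carry the name type assigned by a TyMap; atoms from B on are unused.
  TyMap : Set
  TyMap = ℕ → Maybe NameTy

  IsName : TyMap → ℕ → NameTy → ℕ → Set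
  IsName ty B ν n = n < B × ty n ≡ just ν

  HasType : TyMap → ℕ → Type → LN → Set
  HasType ty B (dty δ)   M = M ≡ unit
  HasType ty B (nty ν)   M = ∃ λ n → IsName ty B ν n × M ≡ fv n
  HasType ty B (aty ν σ) M = ∃ λ n → ∃ λ M′ → IsName ty B ν n × HasType ty B σ M′ × M ≡ absᵛ (fv n) M′

  Sem : Entry → Set
  Sem (V τ) = LN
  Sem (N ν) = ℕ

  Env : Ctx → Set
  Env Σ = ∀ {e} → Σ ∋ e → Sem e

  ext : ∀ {Σ e} → Env Σ → Sem e → Env (Σ ▷ e)
  ext ρ x here      = x
  ext ρ x (there y) = ρ y

  tailᴱ : ∀ {Σ e} → Env (Σ ▷ e) → Env Σ
  tailᴱ ρ x = ρ (there x)

  evalT : ∀ {Σ τ} → Env Σ → Term Σ τ → LN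
  evalT ρ (var x)      = ρ x
  evalT ρ (nm a)       = fv (ρ a)
  evalT ρ (con c)      = unit
  evalT ρ (app f ts)   = unit
  evalT ρ (swap a b t) = swapᵛ (evalT ρ a) (evalT ρ b) (evalT ρ t)
  evalT ρ (abs a t)    = absᵛ (evalT ρ a) (evalT ρ t)

  -- Not a semantics of the connectives: making every non-atomic formula false encodes the
  -- invariant that the antecedents of the sequents we reason about are atomic.
  TrueAtom : ∀ {Σ} → Env Σ → Form Σ → Set
  TrueAtom ρ (rel p ts) = ⊤
  TrueAtom ρ (t ≈ u)    = evalT ρ t ≡ evalT ρ u
  TrueAtom ρ (a # t)    = freshᵛ (evalT ρ a) (evalT ρ t)
  TrueAtom ρ _          = ⊥

  IsFalsum : ∀ {Σ} → Form Σ → Set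
  IsFalsum ⊥ᶠ = ⊤
  IsFalsum _  = ⊥

  -- The last conjunct makes the freshness facts |Σ#a:ν| true.
  Valid : TyMap → ℕ → (Σ : Ctx) → Env Σ → Set
  Valid ty B ∙         ρ = ⊤
  Valid ty B (Σ ▷ V τ) ρ = Valid ty B Σ (tailᴱ ρ) × HasType ty B τ (ρ here)
  Valid ty B (Σ ▷ N ν) ρ = Valid ty B Σ (tailᴱ ρ) × IsName ty B ν (ρ here)
                           × (∀ τ (t : Term Σ τ) → Fresh (ρ here) (evalT (tailᴱ ρ) t))

  evalT-ren : ∀ {Σ Σ′ τ} (r : Ren Σ Σ′) (ρ : Env Σ′) (t : Term Σ τ) →
              evalT ρ (renT r t) ≡ evalT (ρ ∘ r) t
  evalT-ren r ρ (var x)      = refl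
  evalT-ren r ρ (nm a)       = refl
  evalT-ren r ρ (con c)      = refl
  evalT-ren r ρ (app f ts)   = refl
  evalT-ren r ρ (swap a b t) = cong₃ swapᵛ (evalT-ren r ρ a) (evalT-ren r ρ b) (evalT-ren r ρ t)
  evalT-ren r ρ (abs a t)    = cong₂ absᵛ (evalT-ren r ρ a) (evalT-ren r ρ t)

  TrueAtom-ren : ∀ {Σ Σ′} (r : Ren Σ Σ′) (ρ : Env Σ′) (φ : Form Σ) →
                 TrueAtom ρ (renF r φ) ≡ TrueAtom (ρ ∘ r) φ
  TrueAtom-ren r ρ ⊤ᶠ         = refl
  TrueAtom-ren r ρ ⊥ᶠ         = refl
  TrueAtom-ren r ρ (rel p ts) = refl
  TrueAtom-ren r ρ (t ≈ u)    = cong₂ _≡_ (evalT-ren r ρ t) (evalT-ren r ρ u)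
  TrueAtom-ren r ρ (a # t)    = cong₂ freshᵛ (evalT-ren r ρ a) (evalT-ren r ρ t)
  TrueAtom-ren r ρ (φ ∧ ψ)    = refl
  TrueAtom-ren r ρ (φ ∨ ψ)    = refl
  TrueAtom-ren r ρ (φ ⊃ ψ)    = refl
  TrueAtom-ren r ρ (all τ φ)  = refl
  TrueAtom-ren r ρ (ex τ φ)   = refl
  TrueAtom-ren r ρ (new ν φ)  = refl

  evalVal : ∀ {Σ} e → Val Σ e → Env Σ → Sem e
  evalVal (V τ) t ρ = evalT ρ t
  evalVal (N ν) a ρ = ρ a

  evalT-sub : ∀ {Σ Σ′ τ} (σ : Sub Σ Σ′) {ρ′ : Env Σ′} {ρ : Env Σ} →
              (∀ {e} (x : Σ ∋ e) → evalVal e (σ x) ρ′ ≡ ρ x) →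
              (t : Term Σ τ) → evalT ρ′ (subT σ t) ≡ evalT ρ t
  evalT-sub σ σ≗ρ (var x)      = σ≗ρ x
  evalT-sub σ σ≗ρ (nm a)       = cong fv (σ≗ρ a)
  evalT-sub σ σ≗ρ (con c)      = refl
  evalT-sub σ σ≗ρ (app f ts)   = refl
  evalT-sub σ σ≗ρ (swap a b t) = cong₃ swapᵛ (evalT-sub σ σ≗ρ a) (evalT-sub σ σ≗ρ b) (evalT-sub σ σ≗ρ t)
  evalT-sub σ σ≗ρ (abs a t)    = cong₂ absᵛ (evalT-sub σ σ≗ρ a) (evalT-sub σ σ≗ρ t)

  TrueAtom-sub : ∀ {Σ Σ′} (σ : Sub Σ Σ′) {ρ′ : Env Σ′} {ρ : Env Σ} →
                 (∀ {e} (x : Σ ∋ e) → evalVal e (σ x) ρ′ ≡ ρ x) →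
                 (φ : Form Σ) → TrueAtom ρ′ (subF σ φ) ≡ TrueAtom ρ φ
  TrueAtom-sub σ σ≗ρ ⊤ᶠ         = refl
  TrueAtom-sub σ σ≗ρ ⊥ᶠ         = refl
  TrueAtom-sub σ σ≗ρ (rel p ts) = refl
  TrueAtom-sub σ σ≗ρ (t ≈ u)    = cong₂ _≡_ (evalT-sub σ σ≗ρ t) (evalT-sub σ σ≗ρ u)
  TrueAtom-sub σ σ≗ρ (a # t)    = cong₂ freshᵛ (evalT-sub σ σ≗ρ a) (evalT-sub σ σ≗ρ t)
  TrueAtom-sub σ σ≗ρ (φ ∧ ψ)    = refl
  TrueAtom-sub σ σ≗ρ (φ ∨ ψ)    = refl
  TrueAtom-sub σ σ≗ρ (φ ⊃ ψ)    = refl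
  TrueAtom-sub σ σ≗ρ (all τ φ)  = refl
  TrueAtom-sub σ σ≗ρ (ex τ φ)   = refl
  TrueAtom-sub σ σ≗ρ (new ν φ)  = refl

  TrueAtom-[] : ∀ {Σ τ} (ρ : Env Σ) (t : Term Σ τ) (P : Form (Σ ▷ V τ)) →
                TrueAtom ρ (P [ t ]) ≡ TrueAtom (ext ρ (evalT ρ t)) P
  TrueAtom-[] ρ t = TrueAtom-sub (single t) single≗ext
    where
    single≗ext : ∀ {e} (x : _ ∋ e) → evalVal e (single t x) ρ ≡ ext ρ (evalT ρ t) x
    single≗ext here                  = refl
    single≗ext (there {e = V τ} x) = refl
    single≗ext (there {e = N ν} x) = refl

  TrueAtom-[]-cong : ∀ {Σ τ} (ρ : Env Σ) {t u : Term Σ τ} (P : Form (Σ ▷ V τ)) →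
                     evalT ρ t ≡ evalT ρ u → TrueAtom ρ (P [ t ]) → TrueAtom ρ (P [ u ])
  TrueAtom-[]-cong ρ {t} {u} P t≡u
    rewrite TrueAtom-[] ρ t P | TrueAtom-[] ρ u P | t≡u = id

  TrueAtom-wk : ∀ {Σ e} (ρ : Env Σ) (x : Sem e) (Γ : List (Form Σ)) →
                All (TrueAtom ρ) Γ → All (TrueAtom (ext ρ x)) (wkL Γ)
  TrueAtom-wk ρ x Γ = map⁺ ∘ All-map (λ {φ} → subst id (sym (TrueAtom-ren there (ext ρ x) φ)))

  IsFalsum-wk : ∀ {Σ e} (Δ : List (Form Σ)) → All IsFalsum Δ → All IsFalsum (wkL {e = e} Δ)
  IsFalsum-wk Δ = map⁺ ∘ All-map wk
    where
    wk : ∀ {Σ e} {φ : Form Σ} → IsFalsum φ → IsFalsum (wkF {e = e} φ)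
    wk {φ = ⊥ᶠ} tt = tt

  HasType⇒LocallyClosed : ∀ {ty B} τ M → HasType ty B τ M → LocallyClosed 0 M
  HasType⇒LocallyClosed (dty δ)   M refl                    = tt
  HasType⇒LocallyClosed (nty ν)   M (n , _ , refl)          = tt
  HasType⇒LocallyClosed (aty ν σ) M (n , M′ , _ , w , refl) =
    LocallyClosed-close 0 n M′ (HasType⇒LocallyClosed σ M′ w)

  HasType⇒FvBelow : ∀ {ty B} τ M → HasType ty B τ M → FvBelow B M
  HasType⇒FvBelow (dty δ)   M refl                       = tt
  HasType⇒FvBelow (nty ν)   M (n , (n<B , _) , refl)     = n<B
  HasType⇒FvBelow {B = B} (aty ν σ) M (n , M′ , _ , w , refl) =
    FvBelow-close B 0 n M′ (HasType⇒FvBelow σ M′ w)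

  IsName-transpose : ∀ {ty B ν ν′ n m k} → IsName ty B ν n → IsName ty B ν m →
                     IsName ty B ν′ k → IsName ty B ν′ (transpose n m k)
  IsName-transpose {ty} {B} {k = k} (n<B , tyn) (m<B , tym) (k<B , tyk) =
    transpose-closed (_< B) n<B m<B k<B ,
    trans (transpose-respects ty k (trans tyn (sym tym))) tyk

  HasType-rename : ∀ {ty B ν n m} τ M → IsName ty B ν n → IsName ty B ν m →
                   HasType ty B τ M → HasType ty B τ (rename (transpose n m) M)
  HasType-rename (dty δ) M _ _ refl = refl
  HasType-rename {n = n} {m} (nty ν′) M isn ism (k , isk , refl) =
    transpose n m k , IsName-transpose isn ism isk , refl
  HasType-rename {n = n} {m} (aty ν′ σ) M isn ism (k , M′ , isk , w , refl) =
    transpose n m k , rename (transpose n m) M′ , IsName-transpose isn ism isk ,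
    HasType-rename σ M′ isn ism w ,
    cong lam (rename-close (transpose n m) (transpose-injective n m) 0 k M′)

  HasType-swapᵛ : ∀ {ty B ν A A′} τ M → HasType ty B (nty ν) A → HasType ty B (nty ν) A′ →
                  HasType ty B τ M → HasType ty B τ (swapᵛ A A′ M)
  HasType-swapᵛ τ M (n , isn , refl) (m , ism , refl) = HasType-rename τ M isn ism

  HasType-absᵛ : ∀ {ty B ν σ A M} → HasType ty B (nty ν) A → HasType ty B σ M →
                 HasType ty B (aty ν σ) (absᵛ A M)
  HasType-absᵛ {M = M} (n , isn , refl) w = n , M , isn , w , refl

  Valid-tail : ∀ {ty B Σ} e {ρ : Env (Σ ▷ e)} → Valid ty B (Σ ▷ e) ρ → Valid ty B Σ (tailᴱ ρ)
  Valid-tail (V τ) = proj₁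
  Valid-tail (N ν) = proj₁

  lookup-var : ∀ {ty B Σ τ} {ρ : Env Σ} → Valid ty B Σ ρ → (x : Σ ∋ V τ) → HasType ty B τ (ρ x)
  lookup-var (_ , w)        here    = w
  lookup-var v (there {e' = e} x) = lookup-var (Valid-tail e v) x

  lookup-name : ∀ {ty B Σ ν} {ρ : Env Σ} → Valid ty B Σ ρ → (a : Σ ∋ N ν) → IsName ty B ν (ρ a)
  lookup-name (_ , isn , _)  here    = isn
  lookup-name v (there {e' = e} a) = lookup-name (Valid-tail e v) a

  evalT-HasType : ∀ {ty B Σ τ} {ρ : Env Σ} → Valid ty B Σ ρ → (t : Term Σ τ) →
                  HasType ty B τ (evalT ρ t)
  evalT-HasType v (var x)               = lookup-var v x
  evalT-HasType {ρ = ρ} v (nm a)        = ρ a , lookup-name v a , refl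
  evalT-HasType v (con c)               = refl
  evalT-HasType v (app f ts)            = refl
  evalT-HasType {ρ = ρ} v (swap {τ = τ} a b t) =
    HasType-swapᵛ τ (evalT ρ t) (evalT-HasType v a) (evalT-HasType v b) (evalT-HasType v t)
  evalT-HasType v (abs a t)             = HasType-absᵛ (evalT-HasType v a) (evalT-HasType v t)

  isAtom : ∀ {ty B Σ ν} {ρ : Env Σ} → Valid ty B Σ ρ → (a : Term Σ (nty ν)) → IsAtom (evalT ρ a)
  isAtom v a with evalT-HasType v a
  ... | n , _ , a≡n = n , a≡n

  evalT-abs-inversion :
    ∀ {ty B Σ ν τ} {ρ : Env Σ} → Valid ty B Σ ρ → (a b : Term Σ (nty ν)) (t u : Term Σ τ) →
    TrueAtom ρ (abs a t ≈ abs b u) →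
    (TrueAtom ρ (a ≈ b) × TrueAtom ρ (t ≈ u)) ⊎ (TrueAtom ρ (a # u) × TrueAtom ρ (t ≈ swap a b u))
  evalT-abs-inversion {τ = τ} {ρ} v a b t u =
    absᵛ-inversion (isAtom v a) (isAtom v b)
      (HasType⇒LocallyClosed τ (evalT ρ t) (evalT-HasType v t))
      (HasType⇒LocallyClosed τ (evalT ρ u) (evalT-HasType v u))

  distinct-types-fresh : ∀ {ty B Σ ν ν′} {ρ : Env Σ} → Valid ty B Σ ρ → ν ≢ ν′ →
                         (a : Term Σ (nty ν)) (b : Term Σ (nty ν′)) → TrueAtom ρ (a # b)
  distinct-types-fresh {ty} v ν≢ν′ a b with evalT-HasType v a | evalT-HasType v b
  ... | n , (_ , tyn) , eqa | m , (_ , tym) , eqb rewrite eqa | eqb =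
    λ n≡m → ν≢ν′ (just-injective (trans (sym tyn) (trans (cong ty n≡m) tym)))

  axiom-sound : ∀ {ty B Σ Ps Qs} {ρ : Env Σ} → Valid ty B Σ ρ → Axiom Σ Ps Qs →
                All (TrueAtom ρ) Ps → Any (TrueAtom ρ) Qs
  axiom-sound {Σ = Σ} {ρ = ρ} v ax Ps-true = sound-instance ax Ps-true
    where
    at : ∀ {ν} (a : Term Σ (nty ν)) → IsAtom (evalT ρ a)
    at = isAtom v
    sound-instance : ∀ {Ps Qs} → Axiom Σ Ps Qs → All (TrueAtom ρ) Ps → Any (TrueAtom ρ) Qs
    sound-instance (S1 a x)           _ = here (swapᵛ-self (at a) (evalT ρ x))
    sound-instance (S2 a b x)         _ = here (swapᵛ-involutive (at a) (at b) (evalT ρ x))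
    sound-instance (S3 a b)           _ = here (swapᵛ-left (at a) (at b))
    sound-instance (E1 a b c)         _ = here (swapᵛ-unit (at a) (at b))
    sound-instance (E2 a b f ts)      _ = here (swapᵛ-unit (at a) (at b))
    sound-instance (E2swap a b c d t) _ = here (swapᵛ-swapᵛ (at a) (at b) (at c) (at d) (evalT ρ t))
    sound-instance (E2abs a b c t)    _ = here (swapᵛ-absᵛ (at a) (at b) (at c) (evalT ρ t))
    sound-instance (E3 a b p ts)      _ = here tt
    sound-instance (E3eq a b t u) (t≡u ∷ []) = here (cong (swapᵛ (evalT ρ a) (evalT ρ b)) t≡u)
    sound-instance (E3fr a b c t) (c#t ∷ []) =
      here (swapᵛ-freshᵛ (at a) (at b) (at c) (evalT ρ t) c#t)
    sound-instance (F1 a b x) (a#x ∷ b#x ∷ []) = here (swapᵛ-fresh (at a) (at b) (evalT ρ x) a#x b#x)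
    sound-instance (F2 ν≢ν′ a b)      _ = here (distinct-types-fresh v ν≢ν′ a b)
    sound-instance (F3 a)      (a#a ∷ []) = ⊥-elim (freshᵛ-irrefl (at a) a#a)
    sound-instance (F4 a b)           _ with freshᵛ-or-≡ (at a) (at b)
    ... | inj₁ a#b = here a#b
    ... | inj₂ a≡b = there (here a≡b)
    sound-instance (A1 a b x y) (a#y ∷ x≡y ∷ []) =
      here (absᵛ-α (at a) (at b) (evalT ρ x) (evalT ρ y) a#y x≡y)

  freshFact-true : ∀ {ty B Σ φ} {ρ : Env Σ} → Valid ty B Σ ρ → FreshFact Σ φ → TrueAtom ρ φ
  freshFact-true {ρ = ρ} (_ , _ , fresh) (newName {τ = τ} t) =
    subst (Fresh (ρ here)) (sym (evalT-ren there ρ t)) (fresh τ t)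
  freshFact-true {ρ = ρ} v (older {e = e} {φ = φ} ff) =
    subst id (sym (TrueAtom-ren there ρ φ)) (freshFact-true (Valid-tail e v) ff)

  -- Rule F interprets its new name-symbol by the unused atom B.
  assign : TyMap → ℕ → NameTy → TyMap
  assign ty B ν m with m ≟ B
  ... | yes _ = just ν
  ... | no _  = ty m

  IsName-assign-new : ∀ ty B ν → IsName (assign ty B ν) (suc B) ν B
  IsName-assign-new ty B ν with B ≟ B
  ... | yes _  = n<1+n B , refl
  ... | no B≢B = ⊥-elim (B≢B refl)

  IsName-assign : ∀ {ty B ν ν′ n} → IsName ty B ν′ n → IsName (assign ty B ν) (suc B) ν′ n
  IsName-assign {B = B} {n = n} (n<B , tyn) with n ≟ B
  ... | yes refl = ⊥-elim (<-irrefl refl n<B)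
  ... | no _     = m≤n⇒m≤1+n n<B , tyn

  HasType-assign : ∀ {ty B ν} τ M → HasType ty B τ M → HasType (assign ty B ν) (suc B) τ M
  HasType-assign (dty δ)    M w                          = w
  HasType-assign (nty ν′)   M (n , isn , M≡n)            = n , IsName-assign isn , M≡n
  HasType-assign (aty ν′ σ) M (n , M′ , isn , w , M≡)    =
    n , M′ , IsName-assign isn , HasType-assign σ M′ w , M≡

  Valid-assign : ∀ {ty B ν} Σ (ρ : Env Σ) → Valid ty B Σ ρ → Valid (assign ty B ν) (suc B) Σ ρ
  Valid-assign ∙         ρ _                     = tt
  Valid-assign (Σ ▷ V τ) ρ (v , w)               = Valid-assign Σ _ v , HasType-assign τ _ w
  Valid-assign (Σ ▷ N ν) ρ (v , isn , fresh)     = Valid-assign Σ _ v , IsName-assign isn , fresh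

  Valid-new : ∀ {ty B Σ} ν (ρ : Env Σ) → Valid ty B Σ ρ →
              Valid (assign ty B ν) (suc B) (Σ ▷ N ν) (ext ρ B)
  Valid-new {ty} {B} {Σ} ν ρ v = Valid-assign Σ ρ v , IsName-assign-new ty B ν , B-fresh
    where
    B-fresh : ∀ τ (t : Term Σ τ) → Fresh B (evalT ρ t)
    B-fresh τ t = FvBelow⇒Fresh B (evalT ρ t) (HasType⇒FvBelow τ (evalT ρ t) (evalT-HasType v t))

  abs-witness : ∀ {ty B Σ ν σ} (ρ : Env Σ) → Valid ty B Σ ρ → (t : Term Σ (aty ν σ)) →
              ∃ λ n → ∃ λ M → Valid ty B (Σ ▷ V (nty ν) ▷ V σ) (ext (ext ρ (fv n)) M)
                              × TrueAtom (ext (ext ρ (fv n)) M) (wkT (wkT t) ≈ abs (var (there here)) (var here))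
  abs-witness ρ v t with evalT-HasType v t
  ... | n , M , isn , w , t≡⟨n⟩M = n , M , ((v , (n , isn , refl)) , w) ,
    trans (evalT-ren there _ (wkT t)) (trans (evalT-ren there _ t) t≡⟨n⟩M)

  mutual
    sound : ∀ {Σ Γ Δ} → Σ ⨾ Γ ⇒ Δ → ∀ ty B (ρ : Env Σ) → Valid ty B Σ ρ →
            All (TrueAtom ρ) Γ → All IsFalsum Δ → ⊥
    sound (perm Γ↭ Δ↭ d) ty B ρ v Γ✓ Δ⊥ =
      sound d ty B ρ v (All-resp-↭ (↭-sym Γ↭) Γ✓) (All-resp-↭ (↭-sym Δ↭) Δ⊥)
    sound (hyp (rel p ts)) ty B ρ v Γ✓ (() ∷ _)
    sound (hyp (eq t u))   ty B ρ v Γ✓ (() ∷ _)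
    sound (hyp (fr a t))   ty B ρ v Γ✓ (() ∷ _)
    sound ⊤R         ty B ρ v Γ✓ (() ∷ _)
    sound ⊥L         ty B ρ v (() ∷ _) Δ⊥
    sound (∧L d)     ty B ρ v (() ∷ _) Δ⊥
    sound (∧R d d′)  ty B ρ v Γ✓ (() ∷ _)
    sound (∨L d d′)  ty B ρ v (() ∷ _) Δ⊥
    sound (∨R d)     ty B ρ v Γ✓ (() ∷ _)
    sound (⊃L d d′)  ty B ρ v (() ∷ _) Δ⊥
    sound (⊃R d)     ty B ρ v Γ✓ (() ∷ _)
    sound (∀L t d)   ty B ρ v (() ∷ _) Δ⊥
    sound (∀R d)     ty B ρ v Γ✓ (() ∷ _)
    sound (∃L d)     ty B ρ v (() ∷ _) Δ⊥
    sound (∃R t d)   ty B ρ v Γ✓ (() ∷ _)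
    sound (ИR d)     ty B ρ v Γ✓ (() ∷ _)
    sound (ИL d)     ty B ρ v (() ∷ _) Δ⊥
    sound (≈R t d)   ty B ρ v Γ✓ Δ⊥ = sound d ty B ρ v (refl ∷ Γ✓) Δ⊥
    sound (≈S t u P _ d) ty B ρ v (t≡u ∷ Pt ∷ Γ✓) Δ⊥ =
      sound d ty B ρ v (t≡u ∷ Pt ∷ TrueAtom-[]-cong ρ P t≡u Pt ∷ Γ✓) Δ⊥
    sound (Ax {Ps = Ps} ax ds) ty B ρ v Γ✓ Δ⊥ =
      sound-some ds ty B ρ v (axiom-sound v ax (++⁻ˡ Ps Γ✓)) Γ✓ Δ⊥
    sound (A2 a b t u d d′) ty B ρ v (abs≡ ∷ Γ✓) Δ⊥ with evalT-abs-inversion v a b t u abs≡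
    ... | inj₁ (a≡b , t≡u)  = sound d  ty B ρ v (abs≡ ∷ a≡b ∷ t≡u ∷ Γ✓) Δ⊥
    ... | inj₂ (a#u , t≡bu) = sound d′ ty B ρ v (abs≡ ∷ a#u ∷ t≡bu ∷ Γ✓) Δ⊥
    sound {Γ = Γ} {Δ} (A3 t d) ty B ρ v Γ✓ Δ⊥ with abs-witness ρ v t
    ... | n , M , v′ , t≈ = sound d ty B _ v′
      (t≈ ∷ TrueAtom-wk _ M _ (TrueAtom-wk ρ (fv n) Γ Γ✓)) (IsFalsum-wk _ (IsFalsum-wk Δ Δ⊥))
    sound {Γ = Γ} {Δ} (F {ν = ν} d) ty B ρ v Γ✓ Δ⊥ =
      sound d (assign ty B ν) (suc B) (ext ρ B) (Valid-new ν ρ v) (TrueAtom-wk ρ B Γ Γ✓) (IsFalsum-wk Δ Δ⊥)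
    sound (Σ# ff d) ty B ρ v Γ✓ Δ⊥ = sound d ty B ρ v (freshFact-true v ff ∷ Γ✓) Δ⊥

    sound-some : ∀ {Σ Γ Δ Qs} → All (λ Q → Σ ⨾ Q ∷ Γ ⇒ Δ) Qs → ∀ ty B (ρ : Env Σ) →
                 Valid ty B Σ ρ → Any (TrueAtom ρ) Qs → All (TrueAtom ρ) Γ → All IsFalsum Δ → ⊥
    sound-some (d ∷ _)  ty B ρ v (here Q✓)  Γ✓ Δ⊥ = sound d ty B ρ v (Q✓ ∷ Γ✓) Δ⊥
    sound-some (_ ∷ ds) ty B ρ v (there Q✓) Γ✓ Δ⊥ = sound-some ds ty B ρ v Q✓ Γ✓ Δ⊥

mainTheorem7 : (S : Signature) →
    let open NL S in ¬ (∙ ⨾ [] ⇒ ⊥ᶠ ∷ [])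
mainTheorem7 S d = sound d (λ _ → nothing) 0 (λ ()) tt [] (tt ∷ [])
  where open Model S
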